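{- Let $G=(V,E)$ be a finite parity graph and let $u,v\in V$ be two vertices joined by a path in $G$, with distance $d(G,u,v)$. Then \[ \operatorname{sgn}\bigl(\sigma(G_{ -u})\cdot\sigma(G_{ -v})-\sigma(G)\cdot\sigma(G_{ -u-v})\bigr)=(-1)^{d(G,u,v)+1}. \]
   Context: A simple graph $G$ is a parity graph if for any two vertices $u,v$, all induced (chordless) $u$-$v$-paths in $G$ have lengths of the same parity. For a finite simple graph $H$, $\sigma(H)$ denotes the number of independent vertex sets of $H$ (subsets of vertices no two of which are adjacent), including the empty set; the graph with no vertices has $\sigma=1$. $H_{ -w}$ is the graph obtained by deleting vertex $w$ and its incident edges, and $H_{ -u-v}$ is obtained by deleting both $u$ and $v$ (if $u=v$, just that vertex). $d(G,u,v)$ is the graph distance (number of edges of a shortest $u$-$v$-path; $d(G,u,u)=0$). $\operatorname{sgn}$ is the sign function. -}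

module Defs where

open import Data.Bool using (Bool; true; false; _∧_; not; if_then_else_)
open import Data.Nat using (ℕ; zero; suc; _+_; _<_; _%_)
open import Data.Integer using (ℤ; +_; -[1+_]; +[1+_]; -1ℤ; 1ℤ; 0ℤ)
open import Data.Fin using (Fin; zero; suc; toℕ; inject₁; _≟_)
open import Data.List using (List; []; _∷_; map; _++_; length; filter; allFin)
open import Data.Bool.ListAction using (all)
open import Relation.Nullary.Decidable using (T?)
open import Data.Vec using (Vec; []; _∷_; lookup)
open import Function.Definitions using (Injective)
open import Relation.Binary.PropositionalEquality using (_≡_)
open import Relation.Nullary.Decidable using (⌊_⌋)
open import Relation.Unary using (Pred)
open import Data.Product using (Σ; _×_; _,_)

record SimpleGraph (n : ℕ) : Set where
  field
    adj    : Fin n → Fin n → Bool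
    sym    : ∀ i j → adj i j ≡ adj j i
    irrefl : ∀ i → adj i i ≡ false
open SimpleGraph public

Subset : ℕ → Set
Subset n = Vec Bool n

allSubsets : (n : ℕ) → List (Subset n)
allSubsets zero    = [] ∷ []
allSubsets (suc n) = map (false ∷_) (allSubsets n) ++ map (true ∷_) (allSubsets n)

_∈ₛ_ : ∀ {n} → Fin n → Subset n → Bool
i ∈ₛ S = lookup S i

independent : ∀ {n} → SimpleGraph n → Subset n → Bool
independent {n} G S =
  all (λ i → all (λ j → not (i ∈ₛ S ∧ j ∈ₛ S ∧ adj G i j)) (allFin n)) (allFin n)

subsetOf : ∀ {n} → Subset n → (Fin n → Bool) → Bool
subsetOf {n} S W = all (λ i → not (i ∈ₛ S) Data.Bool.∨ W i) (allFin n)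

-- σ(G[W]) : number of independent sets (incl. empty) of the induced
-- subgraph of G on the vertex set W.  (Independent sets of G[W] are
-- exactly the independent sets of G contained in W.)
σ[_] : ∀ {n} → SimpleGraph n → (Fin n → Bool) → ℕ
σ[_] {n} G W = length (filter (λ S → T? (independent G S ∧ subsetOf S W)) (allSubsets n))

-- σ(G), σ(G_{-u}), σ(G_{-u-v}) (if u = v the latter is G_{-u}).
σ : ∀ {n} → SimpleGraph n → ℕ
σ G = σ[ G ] (λ _ → true)

σ₋ : ∀ {n} → SimpleGraph n → Fin n → ℕ
σ₋ G u = σ[ G ] (λ i → not ⌊ i ≟ u ⌋)

σ₋₋ : ∀ {n} → SimpleGraph n → Fin n → Fin n → ℕ
σ₋₋ G u v = σ[ G ] (λ i → not ⌊ i ≟ u ⌋ ∧ not ⌊ i ≟ v ⌋)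

record Path {n} (G : SimpleGraph n) (u v : Fin n) (k : ℕ) : Set where
  field
    vert     : Fin (suc k) → Fin n
    start    : vert zero ≡ u
    end      : vert (Data.Fin.fromℕ k) ≡ v
    distinct : Injective _≡_ _≡_ vert
    step     : ∀ (i : Fin k) → adj G (vert (inject₁ i)) (vert (suc i)) ≡ true

record InducedPath {n} (G : SimpleGraph n) (u v : Fin n) (k : ℕ) : Set where
  field
    path      : Path G u v k
    chordless : ∀ (i j : Fin (suc k)) → suc (toℕ i) < toℕ j →
                adj G (Path.vert path i) (Path.vert path j) ≡ false

IsParityGraph : ∀ {n} → SimpleGraph n → Set
IsParityGraph {n} G = ∀ (u v : Fin n) (k l : ℕ) →
  InducedPath G u v k → InducedPath G u v l → k % 2 ≡ l % 2

IsDistance : ∀ {n} → SimpleGraph n → Fin n → Fin n → ℕ → Set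
IsDistance G u v d = Path G u v d × (∀ k → Path G u v k → d Data.Nat.≤ k)

sgn : ℤ → ℤ
sgn (+ zero)   = 0ℤ
sgn +[1+ _ ]   = 1ℤ
sgn -[1+ _ ]   = -1ℤ

-- Pairs (A , B) of independent sets with u ∉ A and v ∉ B number σ(G₋ᵤ)σ(G₋ᵥ);
-- pairs with u, v ∉ B number σ(G)σ(G₋ᵤ₋ᵥ). Exchanging A and B on the connected component of u
-- in G[A △ B] is an involution of pairs of independent sets which exchanges the memberships of u.
-- Membership in A alternates along every path inside A △ B; shortening a path from u to v to an
-- induced one and using the parity hypothesis, a switched v lies in A iff u does when d is even,
-- and iff u does not when d is odd. So the switch injects the second family into the first when
-- d is odd and the first into the second when d is even. The pair alternating along a shortest
-- u–v path is not in the image, which makes the inequality strict.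

module Submission where

open import Defs
open import Data.Nat using (ℕ; suc)
open import Data.Integer using (ℤ; +_; _-_; _*_; _^_; -1ℤ)
open import Data.Fin using (Fin)
open import Relation.Binary.PropositionalEquality using (_≡_)

open import Data.Bool using (Bool; true; false; not; _∧_; _∨_; _xor_; if_then_else_)
open import Data.Bool.ListAction using (any; all; or)
open import Data.Bool.Properties using (T-≡; ∨-zeroʳ; ¬-not; xor-inverseʳ; xor-identityʳ; xor-comm; not-involutive)
open import Data.Empty using (⊥; ⊥-elim)
open import Data.Fin using (zero; suc; inject₁; fromℕ; toℕ; _≟_)
open import Data.List using (List; []; _∷_; [_]; _++_; length; map; filter; allFin; cartesianProduct; tabulate)
import Data.List as List
open import Data.List.Membership.Propositional using (_∈_; _─_; lose)
open import Data.List.Membership.Propositional.Properties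
  using (∈-allFin; ∈-lookup; ∈-map⁻; ∈-map⁺; ∈-++⁺ˡ; ∈-++⁺ʳ; ∈-filter⁺; ∈-filter⁻;
         ∈-cartesianProduct⁺; ∈-cartesianProduct⁻)
open import Data.List.Properties using (length-removeAt′; length-map; length-++; length-tabulate; map-cong)
open import Data.List.Relation.Binary.Subset.Propositional using (_⊆_)
open import Data.List.Relation.Binary.Subset.Propositional.Properties using (⊆-refl; ⊆-trans; ∷⁺ʳ; All-resp-⊇)
open import Data.List.Relation.Unary.All as All using (All; []; _∷_)
open import Data.List.Relation.Unary.All.Properties using (++⁺)
open import Data.List.Relation.Unary.Any as Any using (Any; here; there; index)
open import Data.List.Relation.Unary.Any.Properties using (any⁺; any⁻)
open import Data.List.Relation.Unary.Unique.Propositional using (Unique; []; _∷_)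
import Data.List.Relation.Unary.Unique.Propositional.Properties as Unique
open import Data.Nat using (zero; _≤_; _<_; _∸_; _%_; z≤n; s≤s)
open import Data.Nat.GeneralisedArithmetic using (fold)
open import Data.Nat.Properties using (≤-refl; ≤-trans; ≤-antisym; m≤n⇒m≤1+n; <⇒≤; <⇒≱; m∸n≡0⇒m≤n)
open import Data.Product using (Σ; ∃; _×_; _,_; proj₁; proj₂)
open import Data.Sum using (_⊎_; inj₁; inj₂)
open import Data.Integer using (1ℤ)
open import Data.Integer.Properties using (pos-*; m-n≡m⊖n; ⊖-≥; ⊖-<)
open import Data.Unit using (⊤; tt)
open import Data.Vec using (lookup)
import Data.Vec as Vec
open import Data.Vec.Properties using (lookup∘tabulate; tabulate-cong; tabulate∘lookup; ∷-injectiveʳ)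
open import Function using (id; _∘_; _⇔_; mk⇔; Equivalence)
open import Function.Definitions using (Injective)
import Relation.Binary.PropositionalEquality as ≡
open import Relation.Binary.PropositionalEquality
  using (_≢_; _≗_; refl; trans; cong; cong₂; subst; subst₂; module ≡-Reasoning)
open import Relation.Nullary using (¬_; Dec; yes; no; contradiction)
open import Relation.Nullary.Decidable using (⌊_⌋; T?; toWitness; fromWitness; _⊎-dec_)

open Equivalence using (to; from)

module _ {a} {A : Set a} where

  ∈-─⁺ : ∀ {x y : A} {ys} (x∈ys : x ∈ ys) → y ∈ ys → x ≢ y → y ∈ (ys ─ x∈ys)
  ∈-─⁺ (here refl) (here refl)  x≢y = contradiction refl x≢y
  ∈-─⁺ (here refl) (there y∈ys) _   = y∈ys
  ∈-─⁺ (there _)   (here refl)  _   = here refl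
  ∈-─⁺ (there x∈ys) (there y∈ys) x≢y = there (∈-─⁺ x∈ys y∈ys x≢y)

  unique-⊆⇒length≤ : ∀ {xs ys : List A} → Unique xs → xs ⊆ ys → length xs ≤ length ys
  unique-⊆⇒length≤ {[]}     _               _     = z≤n
  unique-⊆⇒length≤ {x ∷ xs} {ys} (x∉xs ∷ xs!) xs⊆ys =
    subst (suc (length xs) ≤_) (≡.sym (length-removeAt′ ys (index x∈ys)))
      (s≤s (unique-⊆⇒length≤ xs! λ z∈xs → ∈-─⁺ x∈ys (xs⊆ys (there z∈xs)) (All.lookup x∉xs z∈xs)))
    where x∈ys = xs⊆ys (here refl)

module _ {a b} {A : Set a} {B : Set b} where

  injection-missing⇒length< : ∀ {xs : List A} {ys : List B} {y} (f : A → B) → Unique xs → Injective _≡_ _≡_ f →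
    (∀ {x} → x ∈ xs → f x ∈ ys) → y ∈ ys → (∀ {x} → x ∈ xs → f x ≢ y) → length xs < length ys
  injection-missing⇒length< {xs} {ys} {y} f xs! f-inj f[xs]⊆ys y∈ys y∉f[xs] =
    subst (λ k → suc k ≤ length ys) (length-map f xs) (unique-⊆⇒length≤ y∷f[xs]! y∷f[xs]⊆ys)
    where
    y∷f[xs]! : Unique (y ∷ map f xs)
    y∷f[xs]! = All.tabulate y≢ ∷ Unique.map⁺ f-inj xs!
      where
      y≢ : ∀ {z} → z ∈ map f xs → y ≢ z
      y≢ z∈ y≡z with ∈-map⁻ f z∈
      ... | x , x∈xs , z≡fx = y∉f[xs] x∈xs (≡.sym (trans y≡z z≡fx))
    y∷f[xs]⊆ys : y ∷ map f xs ⊆ ys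
    y∷f[xs]⊆ys (here refl) = y∈ys
    y∷f[xs]⊆ys (there z∈) with ∈-map⁻ f z∈
    ... | x , x∈xs , refl = f[xs]⊆ys x∈xs

  length-cartesianProduct : ∀ (xs : List A) (ys : List B) →
                            length (cartesianProduct xs ys) ≡ length xs Data.Nat.* length ys
  length-cartesianProduct []       ys = refl
  length-cartesianProduct (x ∷ xs) ys =
    trans (length-++ (map (x ,_) ys)) (cong₂ Data.Nat._+_ (length-map (x ,_) ys) (length-cartesianProduct xs ys))

∧-≡true⁻ : ∀ {x y} → x ∧ y ≡ true → x ≡ true × y ≡ true
∧-≡true⁻ {true} {true} _ = refl , refl

∨-≡true⁻ : ∀ {x y} → x ∨ y ≡ true → x ≡ true ⊎ y ≡ true
∨-≡true⁻ {true}  _ = inj₁ refl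
∨-≡true⁻ {false} e = inj₂ e

∨-≡true⁺ˡ : ∀ {x y} → x ≡ true → x ∨ y ≡ true
∨-≡true⁺ˡ refl = refl

∨-≡true⁺ʳ : ∀ {x y} → y ≡ true → x ∨ y ≡ true
∨-≡true⁺ʳ {x} refl = ∨-zeroʳ x

module _ {a} {A : Set a} (p : A → Bool) where

  all-≡true⁻ : ∀ {xs} → all p xs ≡ true → All (λ x → p x ≡ true) xs
  all-≡true⁻ {[]}     _ = []
  all-≡true⁻ {x ∷ xs} e = proj₁ (∧-≡true⁻ e) ∷ all-≡true⁻ (proj₂ (∧-≡true⁻ e))

  all-≡true⁺ : ∀ {xs} → All (λ x → p x ≡ true) xs → all p xs ≡ true
  all-≡true⁺ []         = refl
  all-≡true⁺ (px ∷ pxs) = cong₂ _∧_ px (all-≡true⁺ pxs)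

  any-≡true⁻ : ∀ xs → any p xs ≡ true → ∃ λ x → p x ≡ true
  any-≡true⁻ xs e with Any.satisfied (any⁻ p xs (from T-≡ e))
  ... | x , px = x , to T-≡ px

  any-≡true⁺ : ∀ {x xs} → x ∈ xs → p x ≡ true → any p xs ≡ true
  any-≡true⁺ x∈xs px = to T-≡ (any⁺ p (lose x∈xs (from T-≡ px)))

⌊⌋-≡true⁻ : ∀ {a} {P : Set a} (P? : Dec P) → ⌊ P? ⌋ ≡ true → P
⌊⌋-≡true⁻ P? e = toWitness (from T-≡ e)

⌊⌋-≡true⁺ : ∀ {a} {P : Set a} (P? : Dec P) → P → ⌊ P? ⌋ ≡ true
⌊⌋-≡true⁺ P? p = to T-≡ (fromWitness p)

-- fold true not k, i.e. true negated k times, is the parity test "k is even" used throughout.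
fold-not-%2 : ∀ b k → fold b not k ≡ fold b not (k % 2)
fold-not-%2 b zero          = refl
fold-not-%2 b (suc zero)    = refl
fold-not-%2 b (suc (suc k)) = trans (not-involutive (fold b not k)) (fold-not-%2 b k)

fold-not-cong-%2 : ∀ b {k l} → k % 2 ≡ l % 2 → fold b not k ≡ fold b not l
fold-not-cong-%2 b {k} {l} k≡l = trans (fold-not-%2 b k) (trans (cong (fold b not) k≡l) (≡.sym (fold-not-%2 b l)))

fold-not-not : ∀ b k → fold (not b) not k ≡ not (fold b not k)
fold-not-not b zero    = refl
fold-not-not b (suc k) = cong not (fold-not-not b k)

module Walks {n : ℕ} (G : SimpleGraph n) where

  Edge : Fin n → Fin n → Set
  Edge x y = adj G x y ≡ true

  Edge-irrefl : ∀ {x y} → Edge x y → x ≢ y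
  Edge-irrefl {x} xy refl with () ← trans (≡.sym xy) (irrefl G x)

  end : Fin n → List (Fin n) → Fin n
  end x []       = x
  end x (y ∷ ys) = end y ys

  IsWalk : Fin n → List (Fin n) → Set
  IsWalk x []       = ⊤
  IsWalk x (y ∷ ys) = Edge x y × IsWalk y ys

  IsChordless : Fin n → List (Fin n) → Set
  IsChordless x []       = ⊤
  IsChordless x (y ∷ ys) = All (λ z → adj G x z ≡ false) ys × IsChordless y ys

  IsInducedPath : Fin n → List (Fin n) → Set
  IsInducedPath x ys = IsWalk x ys × Unique (x ∷ ys) × IsChordless x ys

  IsInducedPath-tail : ∀ {x y ys} → IsInducedPath x (y ∷ ys) → IsInducedPath y ys
  IsInducedPath-tail ((_ , w) , (_ ∷ u) , (_ , c)) = w , u , c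

  unique⇒length< : ∀ {x ys} → Unique (x ∷ ys) → length ys < n
  unique⇒length< {ys = ys} x∷ys! =
    subst (suc (length ys) ≤_) (length-tabulate {n = n} id)
      (unique-⊆⇒length≤ {ys = allFin n} x∷ys! (λ {z} _ → ∈-allFin z))

  record Shortcut (x : Fin n) (ys : List (Fin n)) : Set where
    field
      path    : List (Fin n)
      induced : IsInducedPath x path
      sameEnd : end x path ≡ end x ys
      shorter : length path ≤ length ys
      ⊆walk   : path ⊆ ys
  open Shortcut public

  Touches : Fin n → Fin n → Set
  Touches x z = z ≡ x ⊎ Edge x z

  -- Cut y ∷ zs at its last vertex touching x and put x in front.
  prepend : ∀ x y zs → IsInducedPath y zs → Any (Touches x) (y ∷ zs) → Shortcut x (y ∷ zs)
  prepend x y zs p t with Any.any? (λ z → (z ≟ x) ⊎-dec (adj G x z Data.Bool.≟ true)) zs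
  prepend x y (z ∷ zs) p t | yes t′ =
    let s = prepend x z zs (IsInducedPath-tail p) t′ in
    record { path = path s ; induced = induced s ; sameEnd = sameEnd s
           ; shorter = m≤n⇒m≤1+n (shorter s) ; ⊆walk = there ∘ ⊆walk s }
  prepend x y zs p (there t′)      | no ¬t′ = contradiction t′ ¬t′
  prepend x y zs p (here (inj₁ refl)) | no _ =
    record { path = zs ; induced = p ; sameEnd = refl ; shorter = m≤n⇒m≤1+n ≤-refl ; ⊆walk = there }
  prepend x y zs (w , u , c) (here (inj₂ xy)) | no ¬t′ =
    record { path = y ∷ zs
           ; induced = (xy , w) , (x∉ ∷ u) , (x≁ , c)
           ; sameEnd = refl ; shorter = ≤-refl ; ⊆walk = ⊆-refl }
    where
    x≁ : All (λ z → adj G x z ≡ false) zs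
    x≁ = All.tabulate (λ z∈ → ¬-not (λ xz → ¬t′ (lose z∈ (inj₂ xz))))
    x∉ : All (x ≢_) (y ∷ zs)
    x∉ = Edge-irrefl xy ∷ All.tabulate (λ z∈ x≡z → ¬t′ (lose z∈ (inj₁ (≡.sym x≡z))))

  shortcut : ∀ x ys → IsWalk x ys → Shortcut x ys
  shortcut x []       _        =
    record { path = [] ; induced = tt , ([] ∷ []) , tt ; sameEnd = refl ; shorter = z≤n ; ⊆walk = ⊆-refl }
  shortcut x (y ∷ ys) (xy , w) =
    let s = shortcut y ys w
        s′ = prepend x y (path s) (induced s) (here (inj₂ xy))
    in record { path = path s′ ; induced = induced s′ ; sameEnd = trans (sameEnd s′) (sameEnd s)
              ; shorter = ≤-trans (shorter s′) (s≤s (shorter s))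
              ; ⊆walk = ⊆-trans (⊆walk s′) (∷⁺ʳ y (⊆walk s)) }

  walkOfPath : ∀ k (f : Fin (suc k) → Fin n) → (∀ i → Edge (f (inject₁ i)) (f (suc i))) →
               IsWalk (f zero) (tabulate (f ∘ suc)) × end (f zero) (tabulate (f ∘ suc)) ≡ f (fromℕ k)
  walkOfPath zero    f step = tt , refl
  walkOfPath (suc k) f step with walkOfPath k (f ∘ suc) (step ∘ suc)
  ... | w , e = (step zero , w) , e

  private
    lookup-end : ∀ x ys → List.lookup (x ∷ ys) (fromℕ (length ys)) ≡ end x ys
    lookup-end x []       = refl
    lookup-end x (y ∷ ys) = lookup-end y ys

    lookup-step : ∀ x ys → IsWalk x ys →
                  ∀ i → Edge (List.lookup (x ∷ ys) (inject₁ i)) (List.lookup (x ∷ ys) (suc i))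
    lookup-step x (y ∷ ys) (xy , w) zero    = xy
    lookup-step x (y ∷ ys) (xy , w) (suc i) = lookup-step y ys w i

    lookup-injective : ∀ (xs : List (Fin n)) → Unique xs → Injective _≡_ _≡_ (List.lookup xs)
    lookup-injective (x ∷ xs) (x∉ ∷ xs!) {zero}  {zero}  _ = refl
    lookup-injective (x ∷ xs) (x∉ ∷ xs!) {zero}  {suc j} e = contradiction e (All.lookup x∉ (∈-lookup j))
    lookup-injective (x ∷ xs) (x∉ ∷ xs!) {suc i} {zero}  e = contradiction (≡.sym e) (All.lookup x∉ (∈-lookup i))
    lookup-injective (x ∷ xs) (x∉ ∷ xs!) {suc i} {suc j} e = cong suc (lookup-injective xs xs! e)

    lookup-chordless : ∀ x ys → IsChordless x ys → ∀ (i j : Fin (suc (length ys))) → suc (toℕ i) < toℕ j →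
                       adj G (List.lookup (x ∷ ys) i) (List.lookup (x ∷ ys) j) ≡ false
    lookup-chordless x (y ∷ ys) (x≁ , c) zero    (suc zero)    (s≤s ())
    lookup-chordless x (y ∷ ys) (x≁ , c) zero    (suc (suc j)) _       = All.lookup x≁ (∈-lookup j)
    lookup-chordless x (y ∷ ys) (x≁ , c) (suc i) (suc j)       (s≤s i<j) = lookup-chordless y ys c i j i<j

  toInducedPath : ∀ {x ys} → IsInducedPath x ys → InducedPath G x (end x ys) (length ys)
  toInducedPath {x} {ys} (w , u , c) = record
    { path = record
      { vert     = List.lookup (x ∷ ys)
      ; start    = refl
      ; end      = lookup-end x ys
      ; distinct = lookup-injective (x ∷ ys) u
      ; step     = lookup-step x ys w
      }
    ; chordless = lookup-chordless x ys c
    }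

  shortestPath : ∀ {u v d} → IsDistance G u v d →
                 Σ (List (Fin n)) λ ys → IsInducedPath u ys × end u ys ≡ v × length ys ≡ d
  shortestPath {d = d} (p , minimal) with Path.vert p | Path.start p | Path.end p | walkOfPath d (Path.vert p) (Path.step p)
  ... | f | refl | refl | w , e =
    path s , induced s , trans (sameEnd s) e ,
    ≤-antisym (subst (length (path s) ≤_) (length-tabulate (f ∘ suc)) (shorter s)) (minimal _ s-path)
    where
    s = shortcut (f zero) (tabulate (f ∘ suc)) w
    s-path : Path G (f zero) (f (fromℕ d)) (length (path s))
    s-path = subst (λ z → Path G (f zero) z (length (path s))) (trans (sameEnd s) e)
                   (InducedPath.path (toInducedPath (induced s)))

  shortestInducedPath : ∀ {u v d} → IsDistance G u v d → InducedPath G u v d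
  shortestInducedPath dist with shortestPath dist
  ... | ys , p , refl , refl = toInducedPath p

  IsIndependent : (Fin n → Bool) → Set
  IsIndependent a = ∀ i j → a i ≡ true → a j ≡ true → Edge i j → ⊥

  module _ {a b : Fin n → Bool} (a-indep : IsIndependent a) (b-indep : IsIndependent b) where

    alternates : ∀ {x y} → Edge x y → a x xor b x ≡ true → a y xor b y ≡ true → a y ≡ not (a x)
    alternates {x} {y} xy x∈a△b y∈a△b with a x in ax | a y in ay
    ... | true  | true  = ⊥-elim (a-indep x y ax ay xy)
    ... | true  | false = refl
    ... | false | true  = refl
    ... | false | false = ⊥-elim (b-indep x y x∈a△b y∈a△b xy)

    alternation : ∀ x ws → IsWalk x ws → All (λ z → a z xor b z ≡ true) (x ∷ ws) →
                  a (end x ws) ≡ fold (a x) not (length ws)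
    alternation x []       _        _                  = refl
    alternation x (y ∷ ws) (xy , w) (x∈a△b ∷ y∷ws⊆a△b) = begin
      a (end y ws)                     ≡⟨ alternation y ws w y∷ws⊆a△b ⟩
      fold (a y) not (length ws)       ≡⟨ cong (λ c → fold c not (length ws)) a-y ⟩
      fold (not (a x)) not (length ws) ≡⟨ fold-not-not (a x) (length ws) ⟩
      fold (a x) not (suc (length ws)) ∎
      where
      open ≡-Reasoning
      a-y = alternates xy x∈a△b (All.head y∷ws⊆a△b)

  reach : ℕ → (Fin n → Bool) → Fin n → Fin n → Bool
  reach zero    S x w = S x ∧ ⌊ x ≟ w ⌋
  reach (suc f) S x w = S x ∧ (⌊ x ≟ w ⌋ ∨ any (λ y → adj G x y ∧ reach f S y w) (allFin n))

  reach-start : ∀ f S x w → reach f S x w ≡ true → S x ≡ true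
  reach-start zero    S x w e = proj₁ (∧-≡true⁻ e)
  reach-start (suc f) S x w e = proj₁ (∧-≡true⁻ e)

  reach-sound : ∀ f S x w → reach f S x w ≡ true →
                Σ (List (Fin n)) λ ys → IsWalk x ys × end x ys ≡ w × All (λ z → S z ≡ true) (x ∷ ys)
  reach-sound zero S x w e with ∧-≡true⁻ e
  ... | Sx , x≡w = [] , tt , ⌊⌋-≡true⁻ (x ≟ w) x≡w , Sx ∷ []
  reach-sound (suc f) S x w e with ∧-≡true⁻ e
  ... | Sx , h with ∨-≡true⁻ h
  ... | inj₁ x≡w = [] , tt , ⌊⌋-≡true⁻ (x ≟ w) x≡w , Sx ∷ []
  ... | inj₂ h′ with any-≡true⁻ _ (allFin n) h′
  ... | y , h″ with ∧-≡true⁻ h″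
  ... | xy , r with reach-sound f S y w r
  ... | ys , w′ , e′ , Sys = y ∷ ys , (xy , w′) , e′ , Sx ∷ Sys

  reach-complete : ∀ f S x ys → IsWalk x ys → All (λ z → S z ≡ true) (x ∷ ys) → length ys ≤ f →
                   reach f S x (end x ys) ≡ true
  reach-complete zero    S x []       _        (Sx ∷ []) _ = cong₂ _∧_ Sx (⌊⌋-≡true⁺ (x ≟ x) refl)
  reach-complete (suc f) S x []       _        (Sx ∷ []) _ =
    cong₂ _∧_ Sx (∨-≡true⁺ˡ (⌊⌋-≡true⁺ (x ≟ x) refl))
  reach-complete (suc f) S x (y ∷ ys) (xy , w) (Sx ∷ Sys) (s≤s ys≤f) =
    cong₂ _∧_ Sx (∨-≡true⁺ʳ (any-≡true⁺ _ (∈-allFin y) (cong₂ _∧_ xy (reach-complete f S y ys w Sys ys≤f))))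

  reach-cong : ∀ f {S S′} → S ≗ S′ → ∀ x w → reach f S x w ≡ reach f S′ x w
  reach-cong zero    S≗S′ x w = cong (_∧ _) (S≗S′ x)
  reach-cong (suc f) S≗S′ x w =
    cong₂ _∧_ (S≗S′ x) (cong (_ ∨_) (cong or (map-cong step (allFin n))))
    where step = λ y → cong (adj G x y ∧_) (reach-cong f S≗S′ y w)

  -- Fuel n suffices: a walk inside S shortens to a path, which has fewer than n edges.
  component : (Fin n → Bool) → Fin n → Fin n → Bool
  component = reach n

  component-start : ∀ S u → component S u u ≡ S u
  component-start S u with S u in Su
  ... | true  = reach-complete n S u [] tt (Su ∷ []) z≤n
  ... | false = ¬-not (λ c → contradiction (trans (≡.sym (reach-start n S u u c)) Su) λ ())

  component-closed : ∀ S u {x y} → component S u x ≡ true → S y ≡ true → Edge x y → component S u y ≡ true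
  component-closed S u {x} {y} ux Sy xy with reach-sound n S u x ux
  ... | ys , w , refl , Su∷ys =
    subst (λ z → component S u z ≡ true) (trans (sameEnd s) (end-snoc u ys))
      (reach-complete n S u (path s) (proj₁ (induced s))
        (All.head Su∷ys ∷ All-resp-⊇ (⊆walk s) (++⁺ (All.tail Su∷ys) (Sy ∷ [])))
        (<⇒≤ (unique⇒length< (proj₁ (proj₂ (induced s))))))
    where
    walk-snoc : ∀ x ys → IsWalk x ys → Edge (end x ys) y → IsWalk x (ys ++ [ y ])
    walk-snoc x []       _        e = e , tt
    walk-snoc x (z ∷ ys) (xz , w) e = xz , walk-snoc z ys w e
    end-snoc : ∀ x ys → end x (ys ++ [ y ]) ≡ y
    end-snoc x []       = refl
    end-snoc x (z ∷ ys) = end-snoc z ys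
    s = shortcut u (ys ++ [ y ]) (walk-snoc u ys w xy)

  component-parity : IsParityGraph G → ∀ {u v d} → IsDistance G u v d →
                     ∀ {a b} → IsIndependent a → IsIndependent b →
                     component (λ z → a z xor b z) u v ≡ true → a v ≡ fold (a u) not d
  component-parity parity {u} {d = d} dist {a} a-indep b-indep uv with reach-sound n _ u _ uv
  ... | ys , w , refl , u∷ys⊆a△b = begin
    a (end u ys)                      ≡⟨ cong a (sameEnd s) ⟨
    a (end u (path s))                ≡⟨ alternation a-indep b-indep u (path s) (proj₁ (induced s)) u∷p⊆a△b ⟩
    fold (a u) not (length (path s))  ≡⟨ fold-not-cong-%2 (a u) {length (path s)} {d} same-parity ⟩
    fold (a u) not d                  ∎
    where
    open ≡-Reasoning
    s = shortcut u ys w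
    u∷p⊆a△b = All.head u∷ys⊆a△b ∷ All-resp-⊇ (⊆walk s) (All.tail u∷ys⊆a△b)
    induced-s = subst (λ z → InducedPath G u z (length (path s))) (sameEnd s) (toInducedPath (induced s))
    same-parity = parity u _ _ d induced-s (shortestInducedPath dist)

  alternating : Bool → List (Fin n) → Fin n → Bool
  alternating b []       z = false
  alternating b (x ∷ xs) z = if ⌊ z ≟ x ⌋ then b else alternating (not b) xs z

  alternating-head : ∀ b x xs → alternating b (x ∷ xs) x ≡ b
  alternating-head b x xs rewrite ⌊⌋-≡true⁺ (x ≟ x) refl = refl

  alternating-∈ : ∀ {b xs z} → alternating b xs z ≡ true → z ∈ xs
  alternating-∈ {b} {x ∷ xs} {z} e with z ≟ x
  ... | yes refl = here refl
  ... | no _     = there (alternating-∈ e)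

  alternating-not : ∀ b xs {z} → z ∈ xs → alternating (not b) xs z ≡ not (alternating b xs z)
  alternating-not b (x ∷ xs) {z} z∈ with z ≟ x | z∈
  ... | yes _   | _         = refl
  ... | no  z≢x | here z≡x  = contradiction z≡x z≢x
  ... | no  _   | there z∈′ = alternating-not (not b) xs z∈′

  alternating-end : ∀ b x ws → Unique (x ∷ ws) → alternating b (x ∷ ws) (end x ws) ≡ fold b not (length ws)
  alternating-end b x []       _            = alternating-head b x []
  alternating-end b x (y ∷ ws) (x∉ ∷ y∷ws!) with end y ws ≟ x
  ... | yes e = contradiction (≡.sym e) (All.lookup x∉ (end-∈ y ws))
    where
    end-∈ : ∀ y ws → end y ws ∈ y ∷ ws
    end-∈ y []       = here refl
    end-∈ y (z ∷ ws) = there (end-∈ z ws)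
  ... | no _  = trans (alternating-end (not b) y ws y∷ws!) (fold-not-not b (length ws))

  alternating-head-nonadjacent : ∀ {x ws j} → IsInducedPath x ws → alternating false ws j ≡ true → Edge x j → ⊥
  alternating-head-nonadjacent {x} {y ∷ ws} {j} (_ , _ , (x≁ , _)) e xj with j ≟ y | e
  ... | yes _ | ()
  ... | no _  | e′ = contradiction (trans (≡.sym xj) (All.lookup x≁ (alternating-∈ e′))) λ ()

  alternating-independent : ∀ x ws → IsInducedPath x ws → ∀ b → IsIndependent (alternating b (x ∷ ws))
  alternating-independent x ws p b i j i∈ j∈ ij with i ≟ x | j ≟ x
  ... | yes refl | yes refl = Edge-irrefl ij refl
  ... | yes refl | no _     rewrite i∈ = alternating-head-nonadjacent p j∈ ij
  ... | no _     | yes refl rewrite j∈ = alternating-head-nonadjacent p i∈ (trans (sym G j i) ij)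
  alternating-independent x (y ∷ ws) p b i j i∈ j∈ ij | no _ | no _ =
    alternating-independent y ws (IsInducedPath-tail p) (not b) i j i∈ j∈ ij

  module _ {a b c : Fin n → Bool} (a-indep : IsIndependent a) (b-indep : IsIndependent b)
           (c-closed : ∀ {x y} → c x ≡ true → a y xor b y ≡ true → Edge x y → c y ≡ true) where

    private
      across : ∀ {i j} → c i ≡ true → c j ≡ false → b i ≡ true → a j ≡ true → Edge i j → ⊥
      across {i} {j} ci cj bi aj ij with b j in bj
      ... | true  = b-indep i j bi bj ij
      ... | false = contradiction (trans (≡.sym (c-closed ci (cong₂ _xor_ aj bj) ij)) cj) λ ()

    swapOn-independent : IsIndependent (λ i → if c i then b i else a i)
    swapOn-independent i j i∈ j∈ ij with c i in ci | c j in cj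
    ... | true  | true  = b-indep i j i∈ j∈ ij
    ... | false | false = a-indep i j i∈ j∈ ij
    ... | true  | false = across ci cj i∈ j∈ ij
    ... | false | true  = across cj ci j∈ i∈ (trans (sym G j i) ij)

∈-allSubsets : ∀ {m} (S : Subset m) → S ∈ allSubsets m
∈-allSubsets {zero}  Vec.[]          = here refl
∈-allSubsets {suc m} (false Vec.∷ S) = ∈-++⁺ˡ (∈-map⁺ (false Vec.∷_) (∈-allSubsets S))
∈-allSubsets {suc m} (true Vec.∷ S)  =
  ∈-++⁺ʳ (map (false Vec.∷_) (allSubsets m)) (∈-map⁺ (true Vec.∷_) (∈-allSubsets S))

allSubsets-unique : ∀ m → Unique (allSubsets m)
allSubsets-unique zero    = [] ∷ []
allSubsets-unique (suc m) =
  Unique.++⁺ (Unique.map⁺ ∷-injectiveʳ (allSubsets-unique m)) (Unique.map⁺ ∷-injectiveʳ (allSubsets-unique m))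
             disjoint
  where
  disjoint : ∀ {S} → ¬ (S ∈ map (false Vec.∷_) (allSubsets m) × S ∈ map (true Vec.∷_) (allSubsets m))
  disjoint (S∈₀ , S∈₁) with ∈-map⁻ (false Vec.∷_) S∈₀ | ∈-map⁻ (true Vec.∷_) S∈₁
  ... | _ , _ , refl | _ , _ , ()

not-∧³-≡true⇔ : ∀ {x y z} → not (x ∧ y ∧ z) ≡ true ⇔ (x ≡ true → y ≡ true → z ≡ true → ⊥)
not-∧³-≡true⇔ {x} {y} {z} = mk⇔ (⇒ x y z) (⇐ x y z)
  where
  ⇒ : ∀ x y z → not (x ∧ y ∧ z) ≡ true → x ≡ true → y ≡ true → z ≡ true → ⊥
  ⇒ true true true () refl refl refl
  ⇐ : ∀ x y z → (x ≡ true → y ≡ true → z ≡ true → ⊥) → not (x ∧ y ∧ z) ≡ true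
  ⇐ true  true  true  h = ⊥-elim (h refl refl refl)
  ⇐ true  true  false _ = refl
  ⇐ true  false _     _ = refl
  ⇐ false _     _     _ = refl

module IndependentSets {n : ℕ} (G : SimpleGraph n) where
  open Walks G using (IsIndependent)

  independentIn : (Fin n → Bool) → List (Subset n)
  independentIn W = filter (λ S → T? (independent G S ∧ subsetOf S W)) (allSubsets n)

  independentIn-unique : ∀ W → Unique (independentIn W)
  independentIn-unique W = Unique.filter⁺ (λ S → T? (independent G S ∧ subsetOf S W)) (allSubsets-unique n)

  all-allFin⇔ : ∀ (p : Fin n → Bool) → all p (allFin n) ≡ true ⇔ (∀ i → p i ≡ true)
  all-allFin⇔ p = mk⇔ (λ e i → All.lookup (all-≡true⁻ p {allFin n} e) (∈-allFin i))
                      (λ h → all-≡true⁺ p {allFin n} (All.tabulate λ {i} _ → h i))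

  independent⇔ : ∀ S → independent G S ≡ true ⇔ IsIndependent (lookup S)
  independent⇔ S = mk⇔
    (λ e i j → to not-∧³-≡true⇔ (to (all-allFin⇔ _) (to (all-allFin⇔ _) e i) j))
    (λ h → from (all-allFin⇔ _) λ i → from (all-allFin⇔ _) λ j → from not-∧³-≡true⇔ (h i j))

  subsetOf⇔ : ∀ S W → subsetOf S W ≡ true ⇔ (∀ i → lookup S i ≡ true → W i ≡ true)
  subsetOf⇔ S W = mk⇔ (λ e i → ⇒ (to (all-allFin⇔ _) e i)) (λ h → from (all-allFin⇔ _) λ i → ⇐ (h i))
    where
    ⇒ : ∀ {s w} → not s ∨ w ≡ true → s ≡ true → w ≡ true
    ⇒ e refl = e
    ⇐ : ∀ {s w} → (s ≡ true → w ≡ true) → not s ∨ w ≡ true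
    ⇐ {false} _ = refl
    ⇐ {true}  h = h refl

  ∈-independentIn⇔ : ∀ {S W} → S ∈ independentIn W ⇔
                     (IsIndependent (lookup S) × (∀ i → lookup S i ≡ true → W i ≡ true))
  ∈-independentIn⇔ {S} {W} = mk⇔
    (λ S∈ → let indep , sub = ∧-≡true⁻ (to T-≡ (proj₂ (∈-filter⁻ P? {xs = allSubsets n} S∈)))
            in to (independent⇔ S) indep , to (subsetOf⇔ S W) sub)
    (λ (indep , sub) → ∈-filter⁺ P? (∈-allSubsets S)
                         (from T-≡ (cong₂ _∧_ (from (independent⇔ S) indep) (from (subsetOf⇔ S W) sub))))
    where P? = λ S → T? (independent G S ∧ subsetOf S W)

if-xor-second : ∀ x y → (if x xor y then y else x) ≡ y
if-xor-second true  true  = refl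
if-xor-second true  false = refl
if-xor-second false true  = refl
if-xor-second false false = refl

if-xor-first : ∀ x y → (if x xor y then x else y) ≡ x
if-xor-first true  true  = refl
if-xor-first true  false = refl
if-xor-first false true  = refl
if-xor-first false false = refl

module Switching {n : ℕ} (G : SimpleGraph n) (u : Fin n) where
  open Walks G

  Pair : Set
  Pair = Subset n × Subset n

  symDiff : Pair → Fin n → Bool
  symDiff (A , B) z = lookup A z xor lookup B z

  switched : Pair → Fin n → Bool
  switched p = component (symDiff p) u

  switch : Pair → Pair
  switch p@(A , B) = Vec.tabulate (λ i → if switched p i then lookup B i else lookup A i)
                   , Vec.tabulate (λ i → if switched p i then lookup A i else lookup B i)

  lookup-switch₁ : ∀ p i → lookup (proj₁ (switch p)) i ≡
                           (if switched p i then lookup (proj₂ p) i else lookup (proj₁ p) i)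
  lookup-switch₁ p i = lookup∘tabulate _ i

  lookup-switch₂ : ∀ p i → lookup (proj₂ (switch p)) i ≡
                           (if switched p i then lookup (proj₁ p) i else lookup (proj₂ p) i)
  lookup-switch₂ p i = lookup∘tabulate _ i

  symDiff-switch : ∀ p → symDiff (switch p) ≗ symDiff p
  symDiff-switch p@(A , B) z rewrite lookup-switch₁ p z | lookup-switch₂ p z with switched p z
  ... | true  = xor-comm (lookup B z) (lookup A z)
  ... | false = refl

  switched-switch : ∀ p → switched (switch p) ≗ switched p
  switched-switch p = reach-cong n (symDiff-switch p) u

  switch-involutive : ∀ p → switch (switch p) ≡ p
  switch-involutive p@(A , B) =
    cong₂ _,_ (trans (tabulate-cong first) (tabulate∘lookup A)) (trans (tabulate-cong second) (tabulate∘lookup B))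
    where
    first : ∀ i → (if switched (switch p) i then lookup (proj₂ (switch p)) i else lookup (proj₁ (switch p)) i)
                  ≡ lookup A i
    first i rewrite switched-switch p i | lookup-switch₁ p i | lookup-switch₂ p i with switched p i
    ... | true  = refl
    ... | false = refl
    second : ∀ i → (if switched (switch p) i then lookup (proj₁ (switch p)) i else lookup (proj₂ (switch p)) i)
                   ≡ lookup B i
    second i rewrite switched-switch p i | lookup-switch₁ p i | lookup-switch₂ p i with switched p i
    ... | true  = refl
    ... | false = refl

  switch-injective : Injective _≡_ _≡_ switch
  switch-injective {p} {q} e = trans (≡.sym (switch-involutive p)) (trans (cong switch e) (switch-involutive q))

  switch-independent : ∀ {A B} → IsIndependent (lookup A) → IsIndependent (lookup B) →
                       IsIndependent (lookup (proj₁ (switch (A , B)))) × IsIndependent (lookup (proj₂ (switch (A , B))))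
  switch-independent {A} {B} A-indep B-indep =
    respects (lookup-switch₁ (A , B)) (swapOn-independent A-indep B-indep closed) ,
    respects (lookup-switch₂ (A , B)) (swapOn-independent B-indep A-indep closed′)
    where
    closed : ∀ {x y} → switched (A , B) x ≡ true → symDiff (A , B) y ≡ true → Edge x y →
             switched (A , B) y ≡ true
    closed = component-closed _ u
    closed′ : ∀ {x y} → switched (A , B) x ≡ true → lookup B y xor lookup A y ≡ true → Edge x y →
              switched (A , B) y ≡ true
    closed′ {y = y} x∈ y∈ = closed x∈ (trans (xor-comm (lookup A y) (lookup B y)) y∈)
    respects : ∀ {a b} → a ≗ b → IsIndependent b → IsIndependent a
    respects a≗b b-indep i j ai aj = b-indep i j (trans (≡.sym (a≗b i)) ai) (trans (≡.sym (a≗b j)) aj)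

  switched-start : ∀ p → switched p u ≡ symDiff p u
  switched-start p = component-start (symDiff p) u

  switch-at-start₁ : ∀ p → lookup (proj₁ (switch p)) u ≡ lookup (proj₂ p) u
  switch-at-start₁ p@(A , B) =
    trans (lookup-switch₁ p u)
      (trans (cong (if_then lookup B u else lookup A u) (switched-start p)) (if-xor-second (lookup A u) (lookup B u)))

  switch-at-start₂ : ∀ p → lookup (proj₂ (switch p)) u ≡ lookup (proj₁ p) u
  switch-at-start₂ p@(A , B) =
    trans (lookup-switch₂ p u)
      (trans (cong (if_then lookup A u else lookup B u) (switched-start p)) (if-xor-first (lookup A u) (lookup B u)))

sgn[m-n]≡1 : ∀ {m n} → n < m → sgn (+ m - + n) ≡ 1ℤ
sgn[m-n]≡1 {m} {n} n<m rewrite m-n≡m⊖n m n | ⊖-≥ (<⇒≤ n<m) with m ∸ n in e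
... | zero  = contradiction (m∸n≡0⇒m≤n e) (<⇒≱ n<m)
... | suc _ = refl

sgn[m-n]≡-1 : ∀ {m n} → m < n → sgn (+ m - + n) ≡ -1ℤ
sgn[m-n]≡-1 {m} {n} m<n rewrite m-n≡m⊖n m n | ⊖-< m<n with n ∸ m in e
... | zero  = contradiction (m∸n≡0⇒m≤n e) (<⇒≱ m<n)
... | suc _ = refl

-1^≡ : ∀ k → -1ℤ ^ k ≡ (if fold true not k then 1ℤ else -1ℤ)
-1^≡ zero    = refl
-1^≡ (suc k) rewrite -1^≡ k with fold true not k
... | true  = refl
... | false = refl

module Counting {n : ℕ} (G : SimpleGraph n) (parity : IsParityGraph G)
                {u v : Fin n} {d : ℕ} (dist : IsDistance G u v d) where
  open Walks G
  open IndependentSets G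
  open Switching G u

  avoiding⇔ : ∀ (a : Fin n → Bool) w → (∀ i → a i ≡ true → not ⌊ i ≟ w ⌋ ≡ true) ⇔ a w ≡ false
  avoiding⇔ a w = mk⇔ (λ h → ¬-not λ aw → w-excluded (h w aw)) ⇐
    where
    w-excluded : not ⌊ w ≟ w ⌋ ≡ true → ⊥
    w-excluded e with w ≟ w | e
    ... | yes _   | ()
    ... | no w≢w  | _ = w≢w refl
    ⇐ : a w ≡ false → ∀ i → a i ≡ true → not ⌊ i ≟ w ⌋ ≡ true
    ⇐ aw i ai with i ≟ w
    ... | yes refl = contradiction (trans (≡.sym ai) aw) λ ()
    ... | no _     = refl

  X₁ X₂ : List Pair
  X₁ = cartesianProduct (independentIn (λ i → not ⌊ i ≟ u ⌋)) (independentIn (λ i → not ⌊ i ≟ v ⌋))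
  X₂ = cartesianProduct (independentIn (λ _ → true)) (independentIn (λ i → not ⌊ i ≟ u ⌋ ∧ not ⌊ i ≟ v ⌋))

  InX₁ InX₂ : Pair → Set
  InX₁ (A , B) = IsIndependent (lookup A) × IsIndependent (lookup B) × lookup A u ≡ false × lookup B v ≡ false
  InX₂ (A , B) = IsIndependent (lookup A) × IsIndependent (lookup B) × lookup B u ≡ false × lookup B v ≡ false

  ∈X₁⇔ : ∀ {p} → p ∈ X₁ ⇔ InX₁ p
  ∈X₁⇔ {A , B} = mk⇔
    (λ p∈ → let A∈ , B∈ = ∈-cartesianProduct⁻ _ _ p∈
                A-indep , A⊆ = to ∈-independentIn⇔ A∈
                B-indep , B⊆ = to ∈-independentIn⇔ B∈
            in A-indep , B-indep , to (avoiding⇔ _ u) A⊆ , to (avoiding⇔ _ v) B⊆)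
    (λ (A-indep , B-indep , Au , Bv) → ∈-cartesianProduct⁺
      (from ∈-independentIn⇔ (A-indep , from (avoiding⇔ _ u) Au))
      (from ∈-independentIn⇔ (B-indep , from (avoiding⇔ _ v) Bv)))

  ∈X₂⇔ : ∀ {p} → p ∈ X₂ ⇔ InX₂ p
  ∈X₂⇔ {A , B} = mk⇔
    (λ p∈ → let A∈ , B∈ = ∈-cartesianProduct⁻ _ _ p∈
                A-indep , _  = to ∈-independentIn⇔ A∈
                B-indep , B⊆ = to ∈-independentIn⇔ B∈
            in A-indep , B-indep , to (avoiding⇔ _ u) (λ i Bi → proj₁ (∧-≡true⁻ (B⊆ i Bi)))
                                 , to (avoiding⇔ _ v) (λ i Bi → proj₂ (∧-≡true⁻ (B⊆ i Bi))))
    (λ (A-indep , B-indep , Bu , Bv) → ∈-cartesianProduct⁺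
      (from ∈-independentIn⇔ (A-indep , λ _ _ → refl))
      (from ∈-independentIn⇔ (B-indep , λ i Bi →
        cong₂ _∧_ (from (avoiding⇔ _ u) Bu i Bi) (from (avoiding⇔ _ v) Bv i Bi))))

  switched-parity : ∀ {A B} → IsIndependent (lookup A) → IsIndependent (lookup B) → switched (A , B) v ≡ true →
                    lookup A v ≡ fold (lookup A u) not d
  switched-parity {A} {B} = component-parity parity dist {lookup A} {lookup B}

  switch-avoids-end : ∀ {A B} → lookup B v ≡ false → (switched (A , B) v ≡ true → lookup A v ≡ false) →
                      lookup (proj₂ (switch (A , B))) v ≡ false
  switch-avoids-end {A} {B} Bv Av with switched (A , B) v in s
  ... | true  = trans (lookup-switch₂ (A , B) v) (trans (cong (if_then lookup A v else lookup B v) s) (Av refl))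
  ... | false = trans (lookup-switch₂ (A , B) v) (trans (cong (if_then lookup A v else lookup B v) s) Bv)

  -- If v is switched then u is too, so u ∈ A since u ∉ B.
  switch-X₂⊆X₁ : fold true not d ≡ false → ∀ {p} → InX₂ p → InX₁ (switch p)
  switch-X₂⊆X₁ odd {A , B} (A-indep , B-indep , Bu , Bv) =
    proj₁ switched-indep , proj₂ switched-indep , trans (switch-at-start₁ (A , B)) Bu , switch-avoids-end {A} {B} Bv Av
    where
    switched-indep = switch-independent {A} {B} A-indep B-indep
    Av : switched (A , B) v ≡ true → lookup A v ≡ false
    Av s = begin
      lookup A v                  ≡⟨ switched-parity {A} {B} A-indep B-indep s ⟩
      fold (lookup A u) not d     ≡⟨ cong (λ b → fold b not d) Au ⟩
      fold true not d             ≡⟨ odd ⟩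
      false                       ∎
      where
      open ≡-Reasoning
      Au = trans (≡.sym (xor-identityʳ (lookup A u))) (trans (cong (lookup A u xor_) (≡.sym Bu)) (reach-start n _ u v s))

  switch-X₁⊆X₂ : fold true not d ≡ true → ∀ {p} → InX₁ p → InX₂ (switch p)
  switch-X₁⊆X₂ even {A , B} (A-indep , B-indep , Au , Bv) =
    proj₁ switched-indep , proj₂ switched-indep , trans (switch-at-start₂ (A , B)) Au , switch-avoids-end {A} {B} Bv Av
    where
    switched-indep = switch-independent {A} {B} A-indep B-indep
    Av : switched (A , B) v ≡ true → lookup A v ≡ false
    Av s = begin
      lookup A v                  ≡⟨ switched-parity {A} {B} A-indep B-indep s ⟩
      fold (lookup A u) not d     ≡⟨ cong (λ b → fold b not d) Au ⟩
      fold false not d            ≡⟨ fold-not-not true d ⟩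
      not (fold true not d)       ≡⟨ cong not even ⟩
      false                       ∎
      where open ≡-Reasoning

  private
    geodesic : List (Fin n)
    geodesic = proj₁ (shortestPath dist)

    geodesic-induced : IsInducedPath u geodesic
    geodesic-induced = proj₁ (proj₂ (shortestPath dist))

    geodesic-end : end u geodesic ≡ v
    geodesic-end = proj₁ (proj₂ (proj₂ (shortestPath dist)))

    geodesic-length : length geodesic ≡ d
    geodesic-length = proj₂ (proj₂ (proj₂ (shortestPath dist)))

  alternatingPair : Bool → Pair
  alternatingPair b = Vec.tabulate (alternating b (u ∷ geodesic)) , Vec.tabulate (alternating (not b) (u ∷ geodesic))

  alternatingPair-independent : ∀ b → IsIndependent (lookup (proj₁ (alternatingPair b)))
                                    × IsIndependent (lookup (proj₂ (alternatingPair b)))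
  alternatingPair-independent b = tabulated b , tabulated (not b)
    where
    tabulated : ∀ c → IsIndependent (lookup (Vec.tabulate (alternating c (u ∷ geodesic))))
    tabulated c i j ci cj = alternating-independent u geodesic geodesic-induced c i j
      (trans (≡.sym (lookup∘tabulate _ i)) ci) (trans (≡.sym (lookup∘tabulate _ j)) cj)

  alternating-at-end : ∀ b → alternating b (u ∷ geodesic) v ≡ fold b not d
  alternating-at-end b = subst₂ (λ z k → alternating b (u ∷ geodesic) z ≡ fold b not k) geodesic-end geodesic-length
    (alternating-end b u geodesic (proj₁ (proj₂ geodesic-induced)))

  alternatingPair-at-start₁ : ∀ b → lookup (proj₁ (alternatingPair b)) u ≡ b
  alternatingPair-at-start₁ b = trans (lookup∘tabulate _ u) (alternating-head b u geodesic)

  alternatingPair-at-start₂ : ∀ b → lookup (proj₂ (alternatingPair b)) u ≡ not b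
  alternatingPair-at-start₂ b = trans (lookup∘tabulate _ u) (alternating-head (not b) u geodesic)

  alternatingPair-at-end₂ : ∀ b → lookup (proj₂ (alternatingPair b)) v ≡ not (fold b not d)
  alternatingPair-at-end₂ b = trans (lookup∘tabulate _ v) (trans (alternating-at-end (not b)) (fold-not-not b d))

  switched-alternatingPair : ∀ b → switched (alternatingPair b) v ≡ true
  switched-alternatingPair b = subst (λ z → switched (alternatingPair b) z ≡ true) geodesic-end
    (reach-complete n _ u geodesic (proj₁ geodesic-induced) (All.tabulate on-geodesic)
      (<⇒≤ (unique⇒length< (proj₁ (proj₂ geodesic-induced)))))
    where
    on-geodesic : ∀ {z} → z ∈ u ∷ geodesic → symDiff (alternatingPair b) z ≡ true
    on-geodesic {z} z∈ = begin
      symDiff (alternatingPair b) z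
        ≡⟨ cong₂ _xor_ (lookup∘tabulate _ z) (lookup∘tabulate _ z) ⟩
      alternating b (u ∷ geodesic) z xor alternating (not b) (u ∷ geodesic) z
        ≡⟨ cong (alternating b (u ∷ geodesic) z xor_) (alternating-not b (u ∷ geodesic) z∈) ⟩
      alternating b (u ∷ geodesic) z xor not (alternating b (u ∷ geodesic) z)
        ≡⟨ xor-inverseʳ (alternating b (u ∷ geodesic) z) ⟩
      true ∎
      where open ≡-Reasoning

  switch-alternatingPair-at-end : ∀ b → lookup (proj₂ (switch (alternatingPair b))) v ≡ fold b not d
  switch-alternatingPair-at-end b = begin
    lookup (proj₂ (switch y)) v                        ≡⟨ lookup-switch₂ y v ⟩
    (if switched y v then lookup A v else lookup B v)  ≡⟨ cong (if_then lookup A v else lookup B v) y-v ⟩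
    lookup A v                                         ≡⟨ lookup∘tabulate _ v ⟩
    alternating b (u ∷ geodesic) v                     ≡⟨ alternating-at-end b ⟩
    fold b not d                                       ∎
    where
    open ≡-Reasoning
    y = alternatingPair b
    A = proj₁ y
    B = proj₂ y
    y-v = switched-alternatingPair b

  -- The only candidate preimage of the alternating pair is its switch, whose second set contains v.
  switch-injection< : ∀ {Xs Ys : List Pair} b → Unique Xs →
    (∀ {p} → p ∈ Xs → switch p ∈ Ys × lookup (proj₂ p) v ≡ false) →
    alternatingPair b ∈ Ys → fold b not d ≡ true → length Xs < length Ys
  switch-injection< {Xs} b Xs! into y∈Ys fb =
    injection-missing⇒length< switch Xs! switch-injective (λ p∈ → proj₁ (into p∈)) y∈Ys missed
    where
    missed : ∀ {p} → p ∈ Xs → switch p ≢ alternatingPair b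
    missed {p} p∈ e = contradiction (trans (≡.sym (proj₂ (into p∈))) v∈p) λ ()
      where
      p≡ : p ≡ switch (alternatingPair b)
      p≡ = trans (≡.sym (switch-involutive p)) (cong switch e)
      v∈p : lookup (proj₂ p) v ≡ true
      v∈p = trans (cong (λ q → lookup (proj₂ q) v) p≡) (trans (switch-alternatingPair-at-end b) fb)

  odd-distance : fold true not d ≡ false → length X₂ < length X₁
  odd-distance odd =
    switch-injection< false X₂-unique into witness fold-false
    where
    X₂-unique = Unique.cartesianProduct⁺ (independentIn-unique _) (independentIn-unique _)
    fold-false : fold false not d ≡ true
    fold-false = trans (fold-not-not true d) (cong not odd)
    into : ∀ {p} → p ∈ X₂ → switch p ∈ X₁ × lookup (proj₂ p) v ≡ false
    into {p} p∈ = let p-in = to ∈X₂⇔ p∈ in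
      from ∈X₁⇔ (switch-X₂⊆X₁ odd {p} p-in) , proj₂ (proj₂ (proj₂ p-in))
    witness : alternatingPair false ∈ X₁
    witness = let A-indep , B-indep = alternatingPair-independent false in
      from ∈X₁⇔ (A-indep , B-indep , alternatingPair-at-start₁ false ,
                 trans (alternatingPair-at-end₂ false) (cong not fold-false))

  even-distance : fold true not d ≡ true → length X₁ < length X₂
  even-distance even =
    switch-injection< true X₁-unique into witness even
    where
    X₁-unique = Unique.cartesianProduct⁺ (independentIn-unique _) (independentIn-unique _)
    into : ∀ {p} → p ∈ X₁ → switch p ∈ X₂ × lookup (proj₂ p) v ≡ false
    into {p} p∈ = let p-in = to ∈X₁⇔ p∈ in
      from ∈X₂⇔ (switch-X₁⊆X₂ even {p} p-in) , proj₂ (proj₂ (proj₂ p-in))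
    witness : alternatingPair true ∈ X₂
    witness = let A-indep , B-indep = alternatingPair-independent true in
      from ∈X₂⇔ (A-indep , B-indep , alternatingPair-at-start₂ true ,
                 trans (alternatingPair-at-end₂ true) (cong not even))

  σ-products : (+ σ₋ G u) * (+ σ₋ G v) - (+ σ G) * (+ σ₋₋ G u v) ≡ + length X₁ - + length X₂
  σ-products =
    cong₂ _-_ (product (independentIn (λ i → not ⌊ i ≟ u ⌋)) (independentIn (λ i → not ⌊ i ≟ v ⌋)))
              (product (independentIn (λ _ → true)) (independentIn (λ i → not ⌊ i ≟ u ⌋ ∧ not ⌊ i ≟ v ⌋)))
    where
    product : ∀ {A B : Set} (xs : List A) (ys : List B) → + length xs * + length ys ≡ + length (cartesianProduct xs ys)
    product xs ys = trans (≡.sym (pos-* (length xs) (length ys))) (cong +_ (≡.sym (length-cartesianProduct xs ys)))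

  sgn-difference : sgn (+ length X₁ - + length X₂) ≡ -1ℤ ^ suc d
  sgn-difference rewrite -1^≡ (suc d) with fold true not d in parity-d
  ... | true  = sgn[m-n]≡-1 (even-distance parity-d)
  ... | false = sgn[m-n]≡1 (odd-distance parity-d)

corollary3p3 : ∀ {n : ℕ} (G : SimpleGraph n) → IsParityGraph G →
    ∀ (u v : Fin n) (d : ℕ) → IsDistance G u v d →
    sgn ((+ σ₋ G u) * (+ σ₋ G v) - (+ σ G) * (+ σ₋₋ G u v)) ≡ -1ℤ ^ suc d
corollary3p3 G parity u v d dist = trans (cong sgn σ-products) sgn-difference
  where open Counting G parity dist
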